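{- Let $x,y,g,h\in\mathbb{Z}$ with $g,h\neq 0$, $g\mid y$ and $h\mid y$. Let $\mathcal{P}=\{p \text{ prime} : v_p(g)\neq v_p(h)\}$ and for each $p\in\mathcal{P}$ let $s_p=\max\{v_p(g),v_p(h)\}$. Then \[ \gcd(x,y/g)=\gcd(x,y/h) \] holds if and only if \[ v_p(x)\leq v_p(y)-s_p \quad\text{for all } p\in\mathcal{P}. \]
   Context: For a prime $p$ and an integer $n$, $v_p(n)$ denotes the $p$-adic valuation of $n$ (the largest exponent $e$ with $p^e\mid n$, with $v_p(0)=\infty$). -}

module Defs where

open import Data.Nat using (ℕ; suc; _^_)
open import Data.Integer using (ℤ; +_)
open import Data.Integer.Divisibility using (_∣_)
open import Data.Product using (_×_)
open import Relation.Nullary using (¬_)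

-- p-adic valuation, relationally: HasVal p n e  means  v_p(n) = e  (finite).
-- For n = 0 there is no such e (v_p(0) = ∞).
HasVal : ℕ → ℤ → ℕ → Set
HasVal p n e = (+ (p ^ e) ∣ n) × ¬ (+ (p ^ suc e) ∣ n)

-- v_p(n) ≤ e  (for n possibly 0, where v_p(0) = ∞):  p^(e+1) does not divide n.
ValLe : ℕ → ℤ → ℕ → Set
ValLe p n e = ¬ (+ (p ^ suc e) ∣ n)

{-# OPTIONS --safe #-}
module Submission where

-- With a = y/g we have v_p(a) = v_p(y) − v_p(g), so p^k divides gcd(x, a) iff
-- p^k ∣ x and k + v_p(g) ≤ v_p(y).  Hence gcd(x, y/g) ∣ gcd(x, y/h) iff no
-- p^k ∣ x has v_p(y) − v_p(h) < k ≤ v_p(y) − v_p(g), i.e. iff v_p(x) ≤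
-- v_p(y) − v_p(h) whenever v_p(g) < v_p(h); divisibility both ways is the
-- theorem.  Everything is done for absolute values, where d ∣ e is tested on
-- the prime powers dividing d, so x = 0 needs no separate treatment.

module Nat where
  open import Data.Nat.Base
  open import Data.Nat.Properties
  open import Data.Nat.Divisibility
  open import Data.Nat.Primality
  open import Data.Nat.Primality.Factorisation using (PrimeFactorisation; factorise)
  open import Data.Nat.GCD using (gcd; gcd[m,n]∣m; gcd[m,n]∣n; gcd-greatest; gcd[m,n]≢0)
  open import Data.Nat.Induction using (<-wellFounded)
  open import Data.Nat.ListAction using (product)
  open import Data.List.Base using (_∷_)
  open import Data.List.Relation.Unary.All using (All; []; _∷_)
  open import Data.Product.Base using (∃; _×_; _,_; proj₂)
  open import Data.Sum.Base using (inj₁; inj₂)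
  open import Function.Base using (_∘_)
  open import Function.Bundles using (_⇔_; mk⇔; Equivalence)
  open import Induction.WellFounded using (Acc; acc)
  open import Relation.Binary.Definitions using (tri<; tri≈; tri>)
  open import Relation.Binary.PropositionalEquality
  open import Relation.Nullary using (¬_; yes; no; contradiction)

  open Equivalence using (to; from)

  HasValuation : ℕ → ℕ → ℕ → Set
  HasValuation p n e = p ^ e ∣ n × ¬ (p ^ suc e ∣ n)

  ^-monoʳ-∣ : ∀ p {m n} → m ≤ n → p ^ m ∣ p ^ n
  ^-monoʳ-∣ p {m} {n} m≤n = divides (p ^ (n ∸ m)) (begin
    p ^ n                ≡⟨ cong (p ^_) (m∸n+n≡m m≤n) ⟨
    p ^ (n ∸ m + m)      ≡⟨ ^-distribˡ-+-* p (n ∸ m) m ⟩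
    p ^ (n ∸ m) * p ^ m  ∎)
    where open ≡-Reasoning

  ^∣⇒≤ : ∀ {p n e k} → ¬ (p ^ suc e ∣ n) → p ^ k ∣ n → k ≤ e
  ^∣⇒≤ {p} {n} {e} {k} p^[1+e]∤n p^k∣n with k ≤? e
  ... | yes k≤e = k≤e
  ... | no  k≰e = contradiction (∣-trans (^-monoʳ-∣ p (≰⇒> k≰e)) p^k∣n) p^[1+e]∤n

  ^∣⇔≤ : ∀ {p n e k} → HasValuation p n e → p ^ k ∣ n ⇔ k ≤ e
  ^∣⇔≤ {p} (p^e∣n , p^[1+e]∤n) =
    mk⇔ (^∣⇒≤ p^[1+e]∤n) (λ k≤e → ∣-trans (^-monoʳ-∣ p k≤e) p^e∣n)

  hasValuation-mono-∣ : ∀ {p m n e f} → HasValuation p m e → HasValuation p n f → m ∣ n → e ≤ f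
  hasValuation-mono-∣ (p^e∣m , _) (_ , p^[1+f]∤n) m∣n = ^∣⇒≤ p^[1+f]∤n (∣-trans p^e∣m m∣n)

  hasValuation-*p : ∀ {p n e} .{{_ : NonZero p}} → HasValuation p n e → HasValuation p (n * p) (suc e)
  hasValuation-*p {p} {n} {e} (p^e∣n , p^[1+e]∤n) =
    subst (p ^ suc e ∣_) (*-comm p n) (*-monoʳ-∣ p p^e∣n) ,
    p^[1+e]∤n ∘ *-cancelˡ-∣ p ∘ subst (p ^ suc (suc e) ∣_) (*-comm n p)

  hasValuation : ∀ {p} → 1 < p → ∀ n → n ≢ 0 → ∃ (HasValuation p n)
  hasValuation {p} 1<p n = go n (<-wellFounded n)
    where
    instance
      p≢0 : NonZero p
      p≢0 = >-nonZero (<-trans z<s 1<p)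

    go : ∀ n → Acc _<_ n → n ≢ 0 → ∃ (HasValuation p n)
    go n (acc rec) n≢0 with p ∣? n
    ... | no p∤n = 0 , 1∣ n , p∤n ∘ subst (_∣ n) (*-identityʳ p)
    ... | yes (divides q refl) =
      let instance q≢0 = ≢-nonZero (n≢0 ∘ cong (_* p))
          (e , v) = go q (rec (m<m*n q p 1<p)) (≢-nonZero⁻¹ q)
      in suc e , hasValuation-*p {e = e} v

  prime∤prime : ∀ {p q} → Prime p → Prime q → p ≢ q → p ∤ q
  prime∤prime {p} pp pq p≢q p∣q with prime⇒irreducible pq p∣q
  ... | inj₁ p≡1 = nonTrivial⇒≢1 {{prime⇒nonTrivial pp}} p≡1
  ... | inj₂ p≡q = p≢q p≡q

  p^k∣m*n⇒p^k∣m : ∀ {p n} → Prime p → p ∤ n → ∀ k {m} → p ^ k ∣ m * n → p ^ k ∣ m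
  p^k∣m*n⇒p^k∣m {p} {n} pp p∤n zero {m} _ = 1∣ m
  p^k∣m*n⇒p^k∣m {p} {n} pp p∤n (suc k) {m} p^[1+k]∣m*n
    with euclidsLemma m n pp (∣-trans (divides (p ^ k) (*-comm p (p ^ k))) p^[1+k]∣m*n)
  ... | inj₂ p∣n = contradiction p∣n p∤n
  ... | inj₁ (divides m′ refl) =
    subst (p ^ suc k ∣_) (*-comm p m′) (*-monoʳ-∣ p (p^k∣m*n⇒p^k∣m pp p∤n k p^k∣m′*n))
    where
    instance _ = prime⇒nonZero pp
    p^k∣m′*n : p ^ k ∣ m′ * n
    p^k∣m′*n = *-cancelˡ-∣ p
      (subst (p ^ suc k ∣_) (trans (cong (_* n) (*-comm m′ p)) (*-assoc p m′ n)) p^[1+k]∣m*n)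

  p^[k+e]∣m*n⇔p^k∣m : ∀ {p m n e} k → Prime p → HasValuation p n e → p ^ (k + e) ∣ m * n ⇔ p ^ k ∣ m
  p^[k+e]∣m*n⇔p^k∣m {p} {m} {e = e} k pp (p^e∣n@(divides n′ refl) , p^[1+e]∤n) = mk⇔ cancel extend
    where
    instance
      _ = prime⇒nonZero pp
      _ = m^n≢0 p e

    extend : p ^ k ∣ m → p ^ (k + e) ∣ m * (n′ * p ^ e)
    extend p^k∣m = subst (_∣ m * (n′ * p ^ e)) (sym (^-distribˡ-+-* p k e)) (*-pres-∣ p^k∣m p^e∣n)

    p∤n′ : p ∤ n′
    p∤n′ = p^[1+e]∤n ∘ *-monoˡ-∣ (p ^ e)

    cancel : p ^ (k + e) ∣ m * (n′ * p ^ e) → p ^ k ∣ m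
    cancel = p^k∣m*n⇒p^k∣m pp p∤n′ k ∘ *-cancelʳ-∣ (p ^ e)
           ∘ subst₂ _∣_ (^-distribˡ-+-* p k e) (sym (*-assoc m n′ (p ^ e)))

  ^∣quotient⇔≤ : ∀ {p m n e f} k → Prime p → HasValuation p n e → HasValuation p (m * n) f →
                 p ^ k ∣ m ⇔ k + e ≤ f
  ^∣quotient⇔≤ k pp vn vmn = mk⇔
    (to (^∣⇔≤ vmn) ∘ from (p^[k+e]∣m*n⇔p^k∣m k pp vn))
    (to (p^[k+e]∣m*n⇔p^k∣m k pp vn) ∘ from (^∣⇔≤ vmn))

  product-∣ : ∀ {ps} n → All Prime ps → (∀ {q} k → Prime q → q ^ k ∣ product ps → q ^ k ∣ n) →
              product ps ∣ n
  product-∣ n [] _ = 1∣ n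
  product-∣ {p ∷ ps} n (pp ∷ pps) H with p∣n
    where
    p∣n : p ∣ n
    p∣n = subst (_∣ n) (*-identityʳ p) (H 1 pp (*-monoʳ-∣ p (1∣ product ps)))
  ... | divides n′ refl = subst (p * product ps ∣_) (*-comm p n′) (*-monoʳ-∣ p (product-∣ n′ pps H′))
    where
    instance _ = prime⇒nonZero pp
    H′ : ∀ {q} k → Prime q → q ^ k ∣ product ps → q ^ k ∣ n′
    H′ {q} k pq q^k∣ps with q ≟ p
    ... | yes refl = *-cancelˡ-∣ q (subst (q ^ suc k ∣_) (*-comm n′ q) (H (suc k) pq (*-monoʳ-∣ q q^k∣ps)))
    ... | no  q≢p  = p^k∣m*n⇒p^k∣m pq (prime∤prime pq pp q≢p) k (H k pq (∣-trans q^k∣ps (n∣m*n p)))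

  prime-powers-∣⇒∣ : ∀ m n → m ≢ 0 → (∀ {q} k → Prime q → q ^ k ∣ m → q ^ k ∣ n) → m ∣ n
  prime-powers-∣⇒∣ m n m≢0 H =
    subst (_∣ n) (sym isFactorisation)
      (product-∣ n factorsPrime (λ k pq → H k pq ∘ subst (_ ∣_) (sym isFactorisation)))
    where
    instance _ = ≢-nonZero m≢0
    open PrimeFactorisation (factorise m)

  module _ (x y : ℕ) where

    ValuationBound : ℕ → ℕ → Set
    ValuationBound g h = ∀ p → Prime p → ∀ eg eh → HasValuation p g eg → HasValuation p h eh → eg ≢ eh →
                         ∀ ey → HasValuation p y ey → ¬ (p ^ suc (ey ∸ (eg ⊔ eh)) ∣ x)

    ValuationBound< : ℕ → ℕ → Set
    ValuationBound< g h = ∀ p → Prime p → ∀ eg eh → HasValuation p g eg → HasValuation p h eh → eg < eh →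
                          ∀ ey → HasValuation p y ey → ¬ (p ^ suc (ey ∸ eh) ∣ x)

    valuationBound-sym : ∀ {g h} → ValuationBound g h → ValuationBound h g
    valuationBound-sym R p pp eh eg vh vg eh≢eg ey vy =
      subst (λ e → ¬ (p ^ suc (ey ∸ e) ∣ x)) (⊔-comm eg eh) (R p pp eg eh vg vh (eh≢eg ∘ sym) ey vy)

    valuationBound⇒< : ∀ {g h} → ValuationBound g h → ValuationBound< g h
    valuationBound⇒< R p pp eg eh vg vh eg<eh ey vy =
      subst (λ e → ¬ (p ^ suc (ey ∸ e) ∣ x)) (m≤n⇒m⊔n≡n (<⇒≤ eg<eh)) (R p pp eg eh vg vh (<⇒≢ eg<eh) ey vy)

    valuationBound⇔ : ∀ {g h} → ValuationBound g h ⇔ (ValuationBound< g h × ValuationBound< h g)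
    valuationBound⇔ {g} {h} = mk⇔ (λ R → valuationBound⇒< R , valuationBound⇒< (valuationBound-sym R)) bound
      where
      bound : ValuationBound< g h × ValuationBound< h g → ValuationBound g h
      bound (R< , R>) p pp eg eh vg vh eg≢eh ey vy with <-cmp eg eh
      ... | tri< eg<eh _ _ rewrite m≤n⇒m⊔n≡n (<⇒≤ eg<eh) = R< p pp eg eh vg vh eg<eh ey vy
      ... | tri≈ _ eg≡eh _ = contradiction eg≡eh eg≢eh
      ... | tri> _ _ eh<eg rewrite m≥n⇒m⊔n≡m (<⇒≤ eh<eg) = R> p pp eh eg vh vg eh<eg ey vy

    ^∣gcd-quotient⇔ : ∀ {p g a eg ey} k → Prime p → HasValuation p g eg → HasValuation p y ey → y ≡ a * g →
                      p ^ k ∣ gcd x a ⇔ (p ^ k ∣ x × k + eg ≤ ey)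
    ^∣gcd-quotient⇔ {p} {g} {a} {eg} {ey} k pp vg vy refl = mk⇔
      (λ d → ∣-trans d (gcd[m,n]∣m x a) , to p^k∣a⇔ (∣-trans d (gcd[m,n]∣n x a)))
      (λ (p^k∣x , k+eg≤ey) → gcd-greatest p^k∣x (from p^k∣a⇔ k+eg≤ey))
      where
      p^k∣a⇔ : p ^ k ∣ a ⇔ k + eg ≤ ey
      p^k∣a⇔ = ^∣quotient⇔≤ {e = eg} {f = ey} k pp vg vy

    gcd-quotient-∣⇔ : ∀ {g h a b} → g ≢ 0 → h ≢ 0 → y ≡ a * g → y ≡ b * h →
                      gcd x a ∣ gcd x b ⇔ ValuationBound< g h
    gcd-quotient-∣⇔ {g} {h} {a} {b} g≢0 h≢0 y≡ag y≡bh = mk⇔ necessary sufficient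
      where
      necessary : gcd x a ∣ gcd x b → ValuationBound< g h
      necessary ∣gcd p pp eg eh vg vh eg<eh ey vy p^k∣x = n≮n (ey ∸ eh) (m+n≤o⇒m≤o∸n k k+eh≤ey)
        where
        -- p^k divides gcd(x, y/g) but not gcd(x, y/h).
        k : ℕ
        k = suc (ey ∸ eh)
        eh≤ey : eh ≤ ey
        eh≤ey = hasValuation-mono-∣ {e = eh} {f = ey} vh vy (divides b y≡bh)
        k+eg≤ey : k + eg ≤ ey
        k+eg≤ey = m≤o∸n⇒m+n≤o k (<⇒≤ (<-≤-trans eg<eh eh≤ey)) (∸-monoʳ-< eg<eh eh≤ey)
        k+eh≤ey : k + eh ≤ ey
        k+eh≤ey = proj₂ (to (^∣gcd-quotient⇔ k pp vh vy y≡bh)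
                         (∣-trans (from (^∣gcd-quotient⇔ k pp vg vy y≡ag) (p^k∣x , k+eg≤ey)) ∣gcd))

      sufficient : ValuationBound< g h → gcd x a ∣ gcd x b
      sufficient R with y ≟ 0
      ... | yes y≡0 = gcd-greatest (gcd[m,n]∣m x a) (subst (gcd x a ∣_) (sym b≡0) (gcd x a ∣0))
        where
        b≡0 : b ≡ 0
        b≡0 = m*n≡0⇒m≡0 b h {{≢-nonZero h≢0}} (trans (sym y≡bh) y≡0)
      ... | no y≢0 = prime-powers-∣⇒∣ (gcd x a) (gcd x b) gcd≢0 p^k∣gcd
        where
        gcd≢0 : gcd x a ≢ 0
        gcd≢0 = gcd[m,n]≢0 x a (inj₂ (y≢0 ∘ trans y≡ag ∘ cong (_* g)))

        transfer : ∀ {p eg eh ey} k → Prime p → HasValuation p g eg → HasValuation p h eh → HasValuation p y ey →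
                   p ^ k ∣ gcd x a → p ^ k ∣ gcd x b
        transfer {p} {eg} {eh} {ey} k pp vg vh vy p^k∣gcd with to (^∣gcd-quotient⇔ k pp vg vy y≡ag) p^k∣gcd
        ... | p^k∣x , k+eg≤ey = from (^∣gcd-quotient⇔ k pp vh vy y≡bh) (p^k∣x , k+eh≤ey)
          where
          k+eh≤ey : k + eh ≤ ey
          k+eh≤ey with eh ≤? eg
          ... | yes eh≤eg = ≤-trans (+-monoʳ-≤ k eh≤eg) k+eg≤ey
          ... | no  eh≰eg = m≤o∸n⇒m+n≤o k (hasValuation-mono-∣ {e = eh} {f = ey} vh vy (divides b y≡bh))
                              (^∣⇒≤ (R p pp eg eh vg vh (≰⇒> eh≰eg) ey vy) p^k∣x)

        p^k∣gcd : ∀ {p} k → Prime p → p ^ k ∣ gcd x a → p ^ k ∣ gcd x b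
        p^k∣gcd {p} k pp with hasValuation 1<p g g≢0 | hasValuation 1<p h h≢0 | hasValuation 1<p y y≢0
          where
          1<p : 1 < p
          1<p = nonTrivial⇒n>1 p {{prime⇒nonTrivial pp}}
        ... | eg , vg | eh , vh | ey , vy = transfer {eg = eg} {eh} {ey} k pp vg vh vy

    gcd-quotient-≡⇔ : ∀ {g h a b} → g ≢ 0 → h ≢ 0 → y ≡ a * g → y ≡ b * h →
                      gcd x a ≡ gcd x b ⇔ ValuationBound g h
    gcd-quotient-≡⇔ {g} {h} {a} {b} g≢0 h≢0 y≡ag y≡bh = mk⇔
      (λ eq → from valuationBound⇔ (to ab (∣-reflexive eq) , to ba (∣-reflexive (sym eq))))
      (λ R → let (R< , R>) = to valuationBound⇔ R in ∣-antisym (from ab R<) (from ba R>))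
      where
      ab : gcd x a ∣ gcd x b ⇔ ValuationBound< g h
      ab = gcd-quotient-∣⇔ g≢0 h≢0 y≡ag y≡bh
      ba : gcd x b ∣ gcd x a ⇔ ValuationBound< h g
      ba = gcd-quotient-∣⇔ h≢0 g≢0 y≡bh y≡ag

open import Defs
open import Data.Nat using (ℕ; _∸_; _⊔_)
open import Data.Nat.Primality using (Prime)
open import Data.Integer using (ℤ; 0ℤ; _/_; ≢-nonZero)
open import Data.Integer.Divisibility using (_∣_)
open import Data.Integer.GCD using (gcd)
open import Relation.Binary.PropositionalEquality using (_≡_; _≢_)
open import Function.Bundles using (_⇔_)

import Data.Nat as ℕ
open import Data.Nat.DivMod using (m<n⇒m%n≡m)
open import Data.Nat.Divisibility using (n∣m⇒m%n≡0)
open import Data.Integer using (+_; _+_; _*_; _%_; ∣_∣; NonZero)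
open import Data.Integer.Properties using (abs-*; +-identityˡ; +-injective; ∣i∣≡0⇒i≡0)
open import Data.Integer.DivMod using (a≡a%n+[a/n]*n; n%d<d)
import Data.Integer.Divisibility.Signed as Signed
open import Relation.Binary.PropositionalEquality using (sym; trans; cong; subst; module ≡-Reasoning)
open import Function.Base using (_∘_)
open import Function.Bundles using (mk⇔; Equivalence)

[i/j]*j≡i : ∀ i j .{{_ : NonZero j}} → j ∣ i → (i / j) * j ≡ i
[i/j]*j≡i i j j∣i = begin
  (i / j) * j              ≡⟨ +-identityˡ _ ⟨
  + 0 + (i / j) * j        ≡⟨ cong (λ r → + r + (i / j) * j) i%j≡0 ⟨
  + (i % j) + (i / j) * j  ≡⟨ a≡a%n+[a/n]*n i j ⟨
  i                        ∎
  where
  open ≡-Reasoning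
  j∣i%j : j Signed.∣ + (i % j)
  j∣i%j = Signed.∣m+n∣n⇒∣m (subst (j Signed.∣_) (a≡a%n+[a/n]*n i j) (Signed.∣ᵤ⇒∣ j∣i))
                           (Signed.∣n⇒∣m*n (i / j) Signed.∣-refl)
  i%j≡0 : i % j ≡ 0
  i%j≡0 = trans (sym (m<n⇒m%n≡m (n%d<d i j))) (n∣m⇒m%n≡0 (i % j) ∣ j ∣ (Signed.∣⇒∣ᵤ j∣i%j))

lemma2p4 : (x y g h : ℤ) (g≢0 : g ≢ 0ℤ) (h≢0 : h ≢ 0ℤ) → g ∣ y → h ∣ y →
    (gcd x ((y / g) {{≢-nonZero g≢0}}) ≡ gcd x ((y / h) {{≢-nonZero h≢0}}))
    ⇔ ((p : ℕ) → Prime p → (eg eh : ℕ) → HasVal p g eg → HasVal p h eh → eg ≢ eh →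
        (ey : ℕ) → HasVal p y ey → ValLe p x (ey ∸ (eg ⊔ eh)))
lemma2p4 x y g h g≢0 h≢0 g∣y h∣y = mk⇔ (to ∘ +-injective) (cong +_ ∘ from)
  where
  ∣y∣≡∣y/d∣*∣d∣ : ∀ d (d≢0 : d ≢ 0ℤ) → d ∣ y →
                  ∣ y ∣ ≡ ∣ (y / d) {{≢-nonZero d≢0}} ∣ ℕ.* ∣ d ∣
  ∣y∣≡∣y/d∣*∣d∣ d d≢0 d∣y = let instance _ = ≢-nonZero d≢0 in
    trans (cong ∣_∣ (sym ([i/j]*j≡i y d d∣y))) (abs-* (y / d) d)
  -- HasVal and ValLe on ℤ unfold to HasValuation and ¬ p ^ suc e ∣ on
  -- absolute values, so the condition is Nat.ValuationBound definitionally.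
  open Equivalence (Nat.gcd-quotient-≡⇔ ∣ x ∣ ∣ y ∣
                     {a = ∣ (y / g) {{≢-nonZero g≢0}} ∣} {b = ∣ (y / h) {{≢-nonZero h≢0}} ∣}
                     (g≢0 ∘ ∣i∣≡0⇒i≡0) (h≢0 ∘ ∣i∣≡0⇒i≡0)
                     (∣y∣≡∣y/d∣*∣d∣ g g≢0 g∣y) (∣y∣≡∣y/d∣*∣d∣ h h≢0 h∣y))
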